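{- Let $\langle A;\cdot,0,\Diamond\rangle$ be a monadic quasi-implication algebra. Define $1:=x\cdot x$, $x^*:=x\cdot 0$, $x\oplus y:=((x\cdot y)\cdot(y\cdot x))\cdot x$, and $x\odot y:=(x^*\oplus y^*)^*$. Then $\langle A;\odot,\oplus,^*,0,1,\Diamond\rangle$ is a quantum monadic algebra (with $\odot$ as meet and $\oplus$ as join).
   Context: A quasi-implication algebra is a magma $\langle A;\cdot\rangle$ satisfying, for all $x,y,z$: (1) $(x\cdot y)\cdot x=x$; (2) $(x\cdot y)\cdot(x\cdot z)=(y\cdot x)\cdot(y\cdot z)$; (3) $((x\cdot y)\cdot(y\cdot x))\cdot x=((y\cdot x)\cdot(x\cdot y))\cdot y$. In any quasi-implication algebra $x\cdot x=y\cdot y$ for all $x,y$, so $1$ is well defined. A bounded quasi-implication algebra is a quasi-implication algebra with a distinguished element $0$ such that $0\cdot x=1$ for all $x$. A monadic quasi-implication algebra is an algebra $\langle A;\cdot,0,\Diamond\rangle$ such that $\langle A;\cdot,0\rangle$ is a bounded quasi-implication algebra and $\Diamond\colon A\to A$ satisfies, for all $x,y$: (a) $\Diamond\Diamond x\cdot\Diamond x=1$ and $x\cdot\Diamond x=1$; (b) $\Diamond(\Diamond x\cdot 0)=\Diamond x\cdot 0$ and $\Diamond 0=0$; (c) $\Diamond(((x\cdot 0)\cdot(y\cdot 0))\cdot x)=((\Diamond x\cdot 0)\cdot(\Diamond y\cdot 0))\cdot\Diamond x$. An ortholattice is a bounded lattice $\langle A;\wedge,\vee,0,1\rangle$ with a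 unary operation $^{\perp}$ such that $x\wedge x^{\perp}=0$, $x\vee x^{\perp}=1$, $x\le y\Rightarrow y^{\perp}\le x^{\perp}$, and $x^{\perp\perp}=x$. An orthomodular lattice is an ortholattice satisfying: $x\le y$ implies $y=x\vee(x^{\perp}\wedge y)$. A quantum monadic algebra is an orthomodular lattice with a unary operation $\exists$ satisfying for all $x,y$: $\exists 0=0$; $x\le\exists x$; $\exists(x\vee y)=\exists x\vee\exists y$; $\exists\exists x=\exists x$; $\exists((\exists x)^{\perp})=(\exists x)^{\perp}$. -}

module Defs where

open import Level using (Level; suc; _⊔_)
open import Relation.Binary.PropositionalEquality using (_≡_)
open import Algebra.Core using (Op₁; Op₂)
open import Algebra.Lattice.Structures using (IsLattice)

record IsQIA {a : Level} {A : Set a} (_·_ : Op₂ A) : Set a where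
  field
    qia1 : ∀ x y → (x · y) · x ≡ x
    qia2 : ∀ x y z → (x · y) · (x · z) ≡ (y · x) · (y · z)
    qia3 : ∀ x y → ((x · y) · (y · x)) · x ≡ ((y · x) · (x · y)) · y

-- Bounded quasi-implication algebra: 0 · x = 1 (where 1 := x · x).
record IsBoundedQIA {a : Level} {A : Set a} (_·_ : Op₂ A) (𝟘 : A) : Set a where
  field
    isQIA : IsQIA _·_
    zero· : ∀ x → 𝟘 · x ≡ x · x
  open IsQIA isQIA public

record IsMonadicQIA {a : Level} {A : Set a} (_·_ : Op₂ A) (𝟘 : A) (◇ : Op₁ A) : Set a where
  field
    isBoundedQIA : IsBoundedQIA _·_ 𝟘
    ma1 : ∀ x → ◇ (◇ x) · ◇ x ≡ x · x
    ma2 : ∀ x → x · ◇ x ≡ x · x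
    mb1 : ∀ x → ◇ (◇ x · 𝟘) ≡ ◇ x · 𝟘
    mb2 : ◇ 𝟘 ≡ 𝟘
    mc  : ∀ x y → ◇ (((x · 𝟘) · (y · 𝟘)) · x) ≡ ((◇ x · 𝟘) · (◇ y · 𝟘)) · ◇ x
  open IsBoundedQIA isBoundedQIA public

record MonadicQIA (a : Level) : Set (suc a) where
  field
    Carrier : Set a
    _·_     : Op₂ Carrier
    𝟘       : Carrier
    ◇       : Op₁ Carrier
    isMonadicQIA : IsMonadicQIA _·_ 𝟘 ◇
  open IsMonadicQIA isMonadicQIA public

  𝟙 : Carrier
  𝟙 = 𝟘 · 𝟘            -- 1 := x · x (independent of x)

  _* : Op₁ Carrier
  x * = x · 𝟘

  _⊕_ : Op₂ Carrier
  x ⊕ y = ((x · y) · (y · x)) · x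

  _⊙_ : Op₂ Carrier
  x ⊙ y = ((x *) ⊕ (y *)) *

-- Ortholattice ⟨A; ∧, ∨, ⊥, 0, 1⟩; the lattice order is x ≤ y :⇔ x ∧ y = x.
record IsOrtholattice {a : Level} {A : Set a}
         (_∧_ _∨_ : Op₂ A) (_⊥ : Op₁ A) (𝟎 𝟏 : A) : Set a where
  field
    isLattice : IsLattice _≡_ _∨_ _∧_
    bottom    : ∀ x → 𝟎 ∧ x ≡ 𝟎
    top       : ∀ x → x ∧ 𝟏 ≡ x
    compl-∧   : ∀ x → x ∧ (x ⊥) ≡ 𝟎
    compl-∨   : ∀ x → x ∨ (x ⊥) ≡ 𝟏
    antitone  : ∀ x y → x ∧ y ≡ x → (y ⊥) ∧ (x ⊥) ≡ y ⊥
    involutive : ∀ x → (x ⊥) ⊥ ≡ x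

record IsOrthomodularLattice {a : Level} {A : Set a}
         (_∧_ _∨_ : Op₂ A) (_⊥ : Op₁ A) (𝟎 𝟏 : A) : Set a where
  field
    isOrtholattice : IsOrtholattice _∧_ _∨_ _⊥ 𝟎 𝟏
    orthomodular   : ∀ x y → x ∧ y ≡ x → y ≡ x ∨ ((x ⊥) ∧ y)

record IsQuantumMonadicAlgebra {a : Level} {A : Set a}
         (_∧_ _∨_ : Op₂ A) (_⊥ : Op₁ A) (𝟎 𝟏 : A) (∃ : Op₁ A) : Set a where
  field
    isOrthomodularLattice : IsOrthomodularLattice _∧_ _∨_ _⊥ 𝟎 𝟏
    ∃-zero  : ∃ 𝟎 ≡ 𝟎
    ∃-incr  : ∀ x → x ∧ ∃ x ≡ x
    ∃-join  : ∀ x y → ∃ (x ∨ y) ≡ ∃ x ∨ ∃ y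
    ∃-idem  : ∀ x → ∃ (∃ x) ≡ ∃ x
    ∃-compl : ∀ x → ∃ ((∃ x) ⊥) ≡ (∃ x) ⊥

-- On a bounded quasi-implication algebra, x ≤ y :⇔ x · y = 1 is a partial
-- order with least element 0, and the key rule is that y * ≤ x implies
-- x · y = y.  With it, ⊕ is the join and x ↦ x * an antitone involution, so
-- its De Morgan dual ⊙ is the meet; orthomodularity follows from
-- x ⊕ y * = y · x and y = x ⊕ (y · x) * for x ≤ y.  Writing the join as
-- x ⊕ y = (x * · y *) · x turns axiom (c) into additivity of ◇; the other
-- axioms of ◇ are the remaining quantifier laws almost verbatim.
module Submission where

open import Defs
open import Level using (Level)
open import Algebra.Core using (Op₂)
open import Data.Product using (_,_)
open import Relation.Binary.PropositionalEquality
open import Relation.Binary.Structures using (IsPartialOrder)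
open import Relation.Binary.Lattice using (Lattice; Supremum; Infimum)
import Relation.Binary.Lattice.Properties.Lattice as LatticeProperties

module QIAProperties {a : Level} {A : Set a} {_·_ : Op₂ A} (isQIA : IsQIA _·_) where

  open IsQIA isQIA
  open ≡-Reasoning

  x·[x·y]≡x·y : ∀ x y → x · (x · y) ≡ x · y
  x·[x·y]≡x·y x y = trans (cong (_· (x · y)) (sym (qia1 x y))) (qia1 (x · y) x)

  -- u = x · y satisfies u · x = x and x · u = u, so axiom (3) exchanges x and u.
  x·x≡[x·y]·[x·y] : ∀ x y → x · x ≡ (x · y) · (x · y)
  x·x≡[x·y]·[x·y] x y = begin
    x · x
      ≡⟨ cong (_· x) (sym (qia1 x y)) ⟩
    ((x · y) · x) · x
      ≡⟨ cong (λ u → ((x · y) · u) · x) (sym (qia1 x y)) ⟩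
    ((x · y) · ((x · y) · x)) · x
      ≡⟨ cong (λ u → (u · ((x · y) · x)) · x) (sym (x·[x·y]≡x·y x y)) ⟩
    ((x · (x · y)) · ((x · y) · x)) · x
      ≡⟨ sym (qia3 (x · y) x) ⟩
    (((x · y) · x) · (x · (x · y))) · (x · y)
      ≡⟨ cong (λ u → (u · (x · (x · y))) · (x · y)) (qia1 x y) ⟩
    (x · (x · (x · y))) · (x · y)
      ≡⟨ cong (λ u → (x · u) · (x · y)) (x·[x·y]≡x·y x y) ⟩
    (x · (x · y)) · (x · y)
      ≡⟨ cong (_· (x · y)) (x·[x·y]≡x·y x y) ⟩
    (x · y) · (x · y)
      ∎

  [x·y]·[x·z]≡x·[[x·y]·z] : ∀ x y z → (x · y) · (x · z) ≡ x · ((x · y) · z)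
  [x·y]·[x·z]≡x·[[x·y]·z] x y z = begin
    (x · y) · (x · z)                  ≡⟨ cong (_· (x · z)) (sym (x·[x·y]≡x·y x y)) ⟩
    (x · (x · y)) · (x · z)            ≡⟨ sym (qia2 (x · y) x z) ⟩
    ((x · y) · x) · ((x · y) · z)      ≡⟨ cong (_· ((x · y) · z)) (qia1 x y) ⟩
    x · ((x · y) · z)                  ∎

module BoundedQIAProperties {a : Level} {A : Set a} {_·_ : Op₂ A} {𝟘 : A}
                            (isBoundedQIA : IsBoundedQIA _·_ 𝟘) where

  open IsBoundedQIA isBoundedQIA
  open QIAProperties isQIA
  open ≡-Reasoning

  infix  4 _≤_
  infix  30 _*

  𝟙 : A
  𝟙 = 𝟘 · 𝟘

  _* : A → A
  x * = x · 𝟘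

  _⊕_ : Op₂ A
  x ⊕ y = ((x · y) · (y · x)) · x

  _⊙_ : Op₂ A
  x ⊙ y = ((x *) ⊕ (y *)) *

  _≤_ : A → A → Set a
  x ≤ y = x · y ≡ 𝟙

  ⊕-comm : ∀ x y → x ⊕ y ≡ y ⊕ x
  ⊕-comm = qia3

  x·x≡𝟙 : ∀ x → x · x ≡ 𝟙
  x·x≡𝟙 x = begin
    x · x                  ≡⟨ x·x≡[x·y]·[x·y] x x ⟩
    (x · x) · (x · x)      ≡⟨ sym (cong₂ _·_ (zero· x) (zero· x)) ⟩
    (𝟘 · x) · (𝟘 · x)      ≡⟨ sym (x·x≡[x·y]·[x·y] 𝟘 x) ⟩
    𝟙                      ∎

  𝟙·x≡x : ∀ x → 𝟙 · x ≡ x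
  𝟙·x≡x x = trans (cong (_· x) (sym (x·x≡𝟙 x))) (qia1 x x)

  ≤-refl : ∀ {x} → x ≤ x
  ≤-refl {x} = x·x≡𝟙 x

  𝟘≤x : ∀ x → 𝟘 ≤ x
  𝟘≤x x = trans (zero· x) (x·x≡𝟙 x)

  x≤𝟙 : ∀ x → x ≤ 𝟙
  x≤𝟙 x = trans (cong (_· 𝟙) (sym (𝟙·x≡x x))) (qia1 𝟙 x)

  x≤y⇒[x·y]·z≡z : ∀ {x y} z → x ≤ y → (x · y) · z ≡ z
  x≤y⇒[x·y]·z≡z z x≤y = trans (cong (_· z) x≤y) (𝟙·x≡x z)

  x≤y⇒x⊕y≡y : ∀ {x y} → x ≤ y → x ⊕ y ≡ y
  x≤y⇒x⊕y≡y {x} {y} x≤y = begin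
    x ⊕ y                      ≡⟨ ⊕-comm x y ⟩
    ((y · x) · (x · y)) · y    ≡⟨ cong (λ u → ((y · x) · u) · y) x≤y ⟩
    ((y · x) · 𝟙) · y          ≡⟨ cong (_· y) (x≤𝟙 (y · x)) ⟩
    𝟙 · y                      ≡⟨ 𝟙·x≡x y ⟩
    y                          ∎

  ≤-antisym : ∀ {x y} → x ≤ y → y ≤ x → x ≡ y
  ≤-antisym {x} {y} x≤y y≤x = begin
    x        ≡⟨ sym (x≤y⇒x⊕y≡y y≤x) ⟩
    y ⊕ x    ≡⟨ ⊕-comm y x ⟩
    x ⊕ y    ≡⟨ x≤y⇒x⊕y≡y x≤y ⟩
    y        ∎

  ·-monoʳ-≤ : ∀ {x y z} → y ≤ z → x · y ≤ x · z
  ·-monoʳ-≤ {x} {y} {z} y≤z = begin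
    (x · y) · (x · z)    ≡⟨ qia2 x y z ⟩
    (y · x) · (y · z)    ≡⟨ cong ((y · x) ·_) y≤z ⟩
    (y · x) · 𝟙          ≡⟨ x≤𝟙 (y · x) ⟩
    𝟙                    ∎

  ≤-trans : ∀ {x y z} → x ≤ y → y ≤ z → x ≤ z
  ≤-trans {x} {z = z} x≤y y≤z =
    trans (sym (x≤y⇒[x·y]·z≡z (x · z) x≤y)) (·-monoʳ-≤ y≤z)

  ≤-isPartialOrder : IsPartialOrder _≡_ _≤_
  ≤-isPartialOrder = record
    { isPreorder = record
      { isEquivalence = isEquivalence
      ; reflexive     = λ { refl → ≤-refl }
      ; trans         = ≤-trans
      }
    ; antisym    = ≤-antisym
    }

  x≤y⇒x≤y·x : ∀ {x y} → x ≤ y → x ≤ y · x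
  x≤y⇒x≤y·x {x} {y} x≤y = begin
    x · (y · x)                  ≡⟨ sym (x≤y⇒[x·y]·z≡z _ x≤y) ⟩
    (x · y) · (x · (y · x))      ≡⟨ qia2 x y (y · x) ⟩
    (y · x) · (y · (y · x))      ≡⟨ cong ((y · x) ·_) (x·[x·y]≡x·y y x) ⟩
    (y · x) · (y · x)            ≡⟨ ≤-refl ⟩
    𝟙                            ∎

  x≤y⇒x≤z⇒x≤y·z : ∀ {x y z} → x ≤ y → x ≤ z → x ≤ y · z
  x≤y⇒x≤z⇒x≤y·z x≤y x≤z = ≤-trans (x≤y⇒x≤y·x x≤y) (·-monoʳ-≤ x≤z)

  x*≤x·y : ∀ {x y} → x * ≤ x · y
  x*≤x·y {y = y} = ·-monoʳ-≤ (𝟘≤x y)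

  x≤x*·y : ∀ {x y} → x ≤ x * · y
  x≤x*·y {x} {y} = trans (sym ([x·y]·[x·z]≡x·[[x·y]·z] x 𝟘 y)) x*≤x·y

  *-involutive : ∀ x → x * * ≡ x
  *-involutive x = begin
    x * *      ≡⟨ cong (_· 𝟘) (sym (x≤y⇒[x·y]·z≡z (x *) (𝟘≤x x))) ⟩
    𝟘 ⊕ x      ≡⟨ x≤y⇒x⊕y≡y (𝟘≤x x) ⟩
    x          ∎

  x≤y⇒[x·z]·y≡y : ∀ {x y} z → x ≤ y → (x · z) · y ≡ y
  x≤y⇒[x·z]·y≡y {x} {y} z x≤y = trans (cong (_· y) x·z≡y·[[y·x]·z]) (qia1 y _)
    where
    x·z≡y·[[y·x]·z] : x · z ≡ y · ((y · x) · z)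
    x·z≡y·[[y·x]·z] = begin
      x · z                  ≡⟨ sym (x≤y⇒[x·y]·z≡z (x · z) x≤y) ⟩
      (x · y) · (x · z)      ≡⟨ qia2 x y z ⟩
      (y · x) · (y · z)      ≡⟨ [x·y]·[x·z]≡x·[[x·y]·z] y x z ⟩
      y · ((y · x) · z)      ∎

  y*≤x⇒x·y≡y : ∀ {x y} → y * ≤ x → x · y ≡ y
  y*≤x⇒x·y≡y {x} {y} y*≤x = begin
    x · y                  ≡⟨ cong (_· y) (sym (x≤y⇒[x·z]·y≡y 𝟘 y*≤x)) ⟩
    (y * * · x) · y        ≡⟨ x≤y⇒[x·z]·y≡y x (trans (cong (_· y) (*-involutive y)) ≤-refl) ⟩
    y                      ∎

  *-antitone : ∀ {x y} → x ≤ y → y * ≤ x *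
  *-antitone {x} {y} x≤y = subst (y * ≤_) [y·x]·y*≡x* (x≤y⇒x≤y·x x*≤x·y)
    where
    [y·x]·y*≡x* : (y · x) · (y *) ≡ x *
    [y·x]·y*≡x* = trans (sym (qia2 x y 𝟘)) (x≤y⇒[x·y]·z≡z (x *) x≤y)

  x*≤y⇒y*≤x : ∀ {x y} → x * ≤ y → y * ≤ x
  x*≤y⇒y*≤x {x} {y} x*≤y = subst (y * ≤_) (*-involutive x) (*-antitone x*≤y)

  x≤y*⇒y≤x* : ∀ {x y} → x ≤ y * → y ≤ x *
  x≤y*⇒y≤x* {x} {y} x≤y* = subst (_≤ x *) (*-involutive y) (*-antitone x≤y*)

  y*≤u⇒x≤y⇒u·x≤y : ∀ {u x y} → y * ≤ u → x ≤ y → u · x ≤ y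
  y*≤u⇒x≤y⇒u·x≤y {u} {x} y*≤u x≤y = subst (u · x ≤_) (y*≤x⇒x·y≡y y*≤u) (·-monoʳ-≤ x≤y)

  x≤[x·y]·[y·x] : ∀ {x y} → x ≤ (x · y) · (y · x)
  x≤[x·y]·[y·x] {x} {y} = begin
    x · ((x · y) · (y · x))      ≡⟨ sym ([x·y]·[x·z]≡x·[[x·y]·z] x y (y · x)) ⟩
    (x · y) · (x · (y · x))      ≡⟨ qia2 x y (y · x) ⟩
    (y · x) · (y · (y · x))      ≡⟨ cong ((y · x) ·_) (x·[x·y]≡x·y y x) ⟩
    (y · x) · (y · x)            ≡⟨ ≤-refl ⟩
    𝟙                            ∎

  x≤x⊕y : ∀ {x y} → x ≤ x ⊕ y
  x≤x⊕y = x≤y⇒x≤y·x x≤[x·y]·[y·x]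

  y≤x⊕y : ∀ {x y} → y ≤ x ⊕ y
  y≤x⊕y {x} {y} = subst (y ≤_) (⊕-comm y x) x≤x⊕y

  ⊕-least : ∀ {x y z} → x ≤ z → y ≤ z → x ⊕ y ≤ z
  ⊕-least x≤z y≤z = y*≤u⇒x≤y⇒u·x≤y
    (x≤y⇒x≤z⇒x≤y·z (≤-trans (*-antitone x≤z) x*≤x·y) (≤-trans (*-antitone y≤z) x*≤x·y))
    x≤z

  x⊙y≤x : ∀ {x y} → x ⊙ y ≤ x
  x⊙y≤x = x*≤y⇒y*≤x x≤x⊕y

  x⊙y≤y : ∀ {x y} → x ⊙ y ≤ y
  x⊙y≤y = x*≤y⇒y*≤x y≤x⊕y

  ⊙-greatest : ∀ {x y z} → z ≤ x → z ≤ y → z ≤ x ⊙ y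
  ⊙-greatest z≤x z≤y = x≤y*⇒y≤x* (⊕-least (*-antitone z≤x) (*-antitone z≤y))

  ⊕-supremum : Supremum _≤_ _⊕_
  ⊕-supremum x y = x≤x⊕y , y≤x⊕y , λ z → ⊕-least

  ⊙-infimum : Infimum _≤_ _⊙_
  ⊙-infimum x y = x⊙y≤x , x⊙y≤y , λ z → ⊙-greatest

  ≤-lattice : Lattice a a a
  ≤-lattice = record
    { isLattice = record
      { isPartialOrder = ≤-isPartialOrder
      ; supremum       = ⊕-supremum
      ; infimum        = ⊙-infimum
      }
    }

  x≤y⇒x⊙y≡x : ∀ {x y} → x ≤ y → x ⊙ y ≡ x
  x≤y⇒x⊙y≡x x≤y = ≤-antisym x⊙y≤x (⊙-greatest ≤-refl x≤y)

  x⊙y≡x⇒x≤y : ∀ {x y} → x ⊙ y ≡ x → x ≤ y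
  x⊙y≡x⇒x≤y {y = y} x⊙y≡x = subst (_≤ y) x⊙y≡x x⊙y≤y

  x⊕x*≡𝟙 : ∀ x → x ⊕ (x *) ≡ 𝟙
  x⊕x*≡𝟙 x = begin
    ((x · x *) · (x * · x)) · x    ≡⟨ cong₂ (λ u v → (u · v) · x) (x·[x·y]≡x·y x 𝟘) (qia1 x 𝟘) ⟩
    (x * · x) · x                  ≡⟨ cong (_· x) (qia1 x 𝟘) ⟩
    x · x                          ≡⟨ x·x≡𝟙 x ⟩
    𝟙                              ∎

  x⊙x*≡𝟘 : ∀ x → x ⊙ (x *) ≡ 𝟘
  x⊙x*≡𝟘 x = begin
    ((x *) ⊕ (x * *)) *    ≡⟨ cong (λ u → ((x *) ⊕ u) *) (*-involutive x) ⟩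
    ((x *) ⊕ x) *          ≡⟨ cong _* (trans (⊕-comm (x *) x) (x⊕x*≡𝟙 x)) ⟩
    𝟙 *                    ≡⟨ 𝟙·x≡x 𝟘 ⟩
    𝟘                      ∎

  x≤y⇒x⊕y*≡y·x : ∀ {x y} → x ≤ y → x ⊕ (y *) ≡ y · x
  x≤y⇒x⊕y*≡y·x {x} {y} x≤y = ≤-antisym (⊕-least (x≤y⇒x≤y·x x≤y) x*≤x·y) y·x≤x⊕y*
    where
    y·x≤x⊕y* : y · x ≤ x ⊕ (y *)
    y·x≤x⊕y* = subst (y · x ≤_) (y*≤x⇒x·y≡y (x*≤y⇒y*≤x y≤x⊕y)) (·-monoʳ-≤ x≤x⊕y)

  x≤y⇒y≡x⊕[y·x]* : ∀ {x y} → x ≤ y → y ≡ x ⊕ ((y · x) *)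
  x≤y⇒y≡x⊕[y·x]* {x} {y} x≤y = ≤-antisym y≤z (⊕-least x≤y (x*≤y⇒y*≤x x*≤x·y))
    where
    z : A
    z = x ⊕ ((y · x) *)
    y≤z : y ≤ z
    y≤z = begin
      y · z                    ≡⟨ cong (y ·_) (sym (y*≤x⇒x·y≡y (x*≤y⇒y*≤x y≤x⊕y))) ⟩
      y · ((y · x) · z)        ≡⟨ sym ([x·y]·[x·z]≡x·[[x·y]·z] y x z) ⟩
      (y · x) · (y · z)        ≡⟨ sym (qia2 x y z) ⟩
      (x · y) · (x · z)        ≡⟨ x≤y⇒[x·y]·z≡z (x · z) x≤y ⟩
      x · z                    ≡⟨ x≤x⊕y ⟩
      𝟙                        ∎

  orthomodular : ∀ x y → x ⊙ y ≡ x → y ≡ x ⊕ ((x *) ⊙ y)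
  orthomodular x y x⊙y≡x = begin
    y                              ≡⟨ x≤y⇒y≡x⊕[y·x]* x≤y ⟩
    x ⊕ ((y · x) *)                ≡⟨ cong (λ u → x ⊕ (u *)) (sym (x≤y⇒x⊕y*≡y·x x≤y)) ⟩
    x ⊕ ((x ⊕ (y *)) *)            ≡⟨ cong (λ u → x ⊕ ((u ⊕ (y *)) *)) (sym (*-involutive x)) ⟩
    x ⊕ ((x *) ⊙ y)                ∎
    where
    x≤y : x ≤ y
    x≤y = x⊙y≡x⇒x≤y x⊙y≡x

  isOrthomodularLattice : IsOrthomodularLattice _⊙_ _⊕_ _* 𝟘 𝟙
  isOrthomodularLattice = record
    { isOrtholattice = record
      { isLattice  = LatticeProperties.isAlgLattice ≤-lattice
      ; bottom     = λ x → x≤y⇒x⊙y≡x (𝟘≤x x)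
      ; top        = λ x → x≤y⇒x⊙y≡x (x≤𝟙 x)
      ; compl-∧    = x⊙x*≡𝟘
      ; compl-∨    = x⊕x*≡𝟙
      ; antitone   = λ x y x⊙y≡x → x≤y⇒x⊙y≡x (*-antitone (x⊙y≡x⇒x≤y x⊙y≡x))
      ; involutive = *-involutive
      }
    ; orthomodular = orthomodular
    }

  x⊕y≡[x*·y*]·x : ∀ x y → x ⊕ y ≡ ((x *) · (y *)) · x
  x⊕y≡[x*·y*]·x x y = ≤-antisym (⊕-least (x≤y⇒x≤y·x x≤x*·y) y≤[x*·y*]·x) [x*·y*]·x≤x⊕y
    where
    y≤[x*·y*]·x : y ≤ ((x *) · (y *)) · x
    y≤[x*·y*]·x = subst (y ≤_) [y*·x*]·[y*·x]≡[x*·y*]·x (x≤y⇒x≤z⇒x≤y·z x≤x*·y x≤x*·y)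
      where
      [y*·x*]·[y*·x]≡[x*·y*]·x : ((y *) · (x *)) · ((y *) · x) ≡ ((x *) · (y *)) · x
      [y*·x*]·[y*·x]≡[x*·y*]·x =
        trans (sym (qia2 (x *) (y *) x)) (cong (((x *) · (y *)) ·_) (qia1 x 𝟘))
    [x*·y*]·x≤x⊕y : ((x *) · (y *)) · x ≤ x ⊕ y
    [x*·y*]·x≤x⊕y = y*≤u⇒x≤y⇒u·x≤y
      (x≤y⇒x≤z⇒x≤y·z (*-antitone x≤x⊕y) (*-antitone y≤x⊕y)) x≤x⊕y

module MonadicQIAProperties {a : Level} (M : MonadicQIA a) where

  open MonadicQIA M using (_·_; 𝟘; ◇; isBoundedQIA; ma1; ma2; mb1; mb2; mc)
  open BoundedQIAProperties isBoundedQIA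

  x≤◇x : ∀ x → x ≤ ◇ x
  x≤◇x x = trans (ma2 x) ≤-refl

  ◇-distrib-⊕ : ∀ x y → ◇ (x ⊕ y) ≡ ◇ x ⊕ ◇ y
  ◇-distrib-⊕ x y = begin
    ◇ (x ⊕ y)                               ≡⟨ cong ◇ (x⊕y≡[x*·y*]·x x y) ⟩
    ◇ (((x *) · (y *)) · x)                 ≡⟨ mc x y ⟩
    ((◇ x *) · (◇ y *)) · ◇ x               ≡⟨ sym (x⊕y≡[x*·y*]·x (◇ x) (◇ y)) ⟩
    ◇ x ⊕ ◇ y                               ∎
    where open ≡-Reasoning

  isQuantumMonadicAlgebra : IsQuantumMonadicAlgebra _⊙_ _⊕_ _* 𝟘 𝟙 ◇
  isQuantumMonadicAlgebra = record
    { isOrthomodularLattice = isOrthomodularLattice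
    ; ∃-zero  = mb2
    ; ∃-incr  = λ x → x≤y⇒x⊙y≡x (x≤◇x x)
    ; ∃-join  = ◇-distrib-⊕
    ; ∃-idem  = λ x → ≤-antisym (trans (ma1 x) ≤-refl) (x≤◇x (◇ x))
    ; ∃-compl = mb1
    }

theorem4p6 : {a : Level} (M : MonadicQIA a) →
    IsQuantumMonadicAlgebra (MonadicQIA._⊙_ M) (MonadicQIA._⊕_ M) (MonadicQIA._* M)
      (MonadicQIA.𝟘 M) (MonadicQIA.𝟙 M) (MonadicQIA.◇ M)
theorem4p6 M = MonadicQIAProperties.isQuantumMonadicAlgebra M
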